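{- Let $G=(V,E)$ be a connected finite simple graph with $n=|V|$, and let $\mathcal G$ be the graph constructed from $G$ as described in the context. Let $\mathcal S$ be a proper stalled subset of the vertex set of $\mathcal G$ such that $|\mathcal S|\geqslant (2n+1)|E|+2$. Then $\mathcal S\cap V$ is an independent set of $G$.
   Context: For a finite simple graph $H$ with vertex set $W$ and a set $F\subseteq W$: a vertex $v\in W\setminus F$ is forced by $F$ if there is $u\in F$ such that $v$ is the unique neighbor of $u$ outside $F$. $F$ is stalled if no vertex of $W\setminus F$ is forced by $F$; $F$ is proper if $F\neq W$. Construction of $\mathcal G$: given $G=(V,E)$ with $n=|V|$, let $E^i=\{e^i : e\in E\}$ for $i=0,1,\dots,2n$ be $2n+1$ pairwise disjoint copies of $E$ (disjoint from $V$), and let $\varepsilon$ be a further new vertex. The vertex set of $\mathcal G$ is $\mathcal V=V\cup E^0\cup\dots\cup E^{2n}\cup\{\varepsilon\}$. The edges of $\mathcal G$ are exactly: for every edge $e=\{u,v\}\in E$, the edges $\{u,e^0\}$ and $\{e^0,v\}$; the edges $\{e^i,e^{i+1}\}$ for $0\le i\le 2n-1$; and the edge $\{\varepsilon,e^0\}$. -}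

module Defs where

open import Data.Nat using (ℕ; zero; suc; _+_; _*_; _≤_)
open import Data.Fin using (Fin; toℕ)
open import Data.Fin.Base using () renaming (zero to fzero)
open import Data.Bool using (Bool; true; false)
open import Data.List using (List; []; _∷_; _++_; map; concatMap; length; filterᵇ; allFin)
open import Data.Product using (Σ; _×_; _,_; proj₁; proj₂; ∃)
open import Data.Sum using (_⊎_)
open import Relation.Binary.PropositionalEquality using (_≡_; _≢_)
open import Relation.Nullary using (¬_)

record SimpleGraph : Set where
  field
    n     : ℕ
    m     : ℕ
    ends  : Fin m → Fin n × Fin n
    loopless : ∀ e → proj₁ (ends e) ≢ proj₂ (ends e)
    distinct : ∀ e f →
      (ends e ≡ ends f ⊎ (proj₁ (ends e) ≡ proj₂ (ends f) × proj₂ (ends e) ≡ proj₁ (ends f))) →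
      e ≡ f

module _ (G : SimpleGraph) where
  open SimpleGraph G

  AdjG : Fin n → Fin n → Set
  AdjG u v = ∃ λ e → ends e ≡ (u , v) ⊎ ends e ≡ (v , u)

  data Reach : Fin n → Fin n → Set where
    here : ∀ {u} → Reach u u
    step : ∀ {u v w} → AdjG u v → Reach v w → Reach u w

  Connected : Set
  Connected = ∀ u v → Reach u v

  IndependentG : (Fin n → Set) → Set
  IndependentG S = ∀ u v → AdjG u v → ¬ (S u × S v)

  -- The graph 𝒢.  Vertices: V, copies E^i (i = 0..2n), and ε.

  data Vtx : Set where
    vert : Fin n → Vtx
    edg  : Fin (suc (2 * n)) → Fin m → Vtx
    eps  : Vtx

  -- one orientation of each edge of 𝒢
  data Arc : Vtx → Vtx → Set where
    vert-edg : ∀ u e → (proj₁ (ends e) ≡ u ⊎ proj₂ (ends e) ≡ u) → Arc (vert u) (edg fzero e)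
    edg-edg  : ∀ i j e → toℕ j ≡ suc (toℕ i) → Arc (edg i e) (edg j e)
    eps-edg  : ∀ e → Arc eps (edg fzero e)

  Adj : Vtx → Vtx → Set
  Adj x y = Arc x y ⊎ Arc y x

  -- enumeration of all vertices of 𝒢 (each exactly once)
  allVtx : List Vtx
  allVtx = map vert (allFin n)
        ++ concatMap (λ i → map (edg i) (allFin m)) (allFin (suc (2 * n)))
        ++ (eps ∷ [])

  _∈S_ : Vtx → (Vtx → Bool) → Set
  x ∈S S = S x ≡ true

  card : (Vtx → Bool) → ℕ
  card S = length (filterᵇ S allVtx)

  Forced : (Vtx → Bool) → Vtx → Set
  Forced F v = ¬ (v ∈S F) × Σ Vtx λ u → u ∈S F × Adj u v ×
               (∀ w → Adj u w → ¬ (w ∈S F) → w ≡ v)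

  Stalled : (Vtx → Bool) → Set
  Stalled F = ∀ v → ¬ Forced F v

  Proper : (Vtx → Bool) → Set
  Proper F = ¬ (∀ v → v ∈S F)

module Submission where

-- Write N = 2n.  Since 𝒢 has n + (N + 1)|E| + 1 vertices, fewer than n of them lie outside 𝒮.
-- Above e⁰ the copies e¹, …, eᴺ of an edge e form a pendant path on which a stalled set
-- propagates: two consecutive copies in 𝒮 force all higher ones, and eᴺ ∈ 𝒮 forces all lower
-- ones.  If eᴺ ∉ 𝒮, then no two consecutive copies lie in 𝒮, so at least n of the N + 1 copies
-- are outside 𝒮, which is impossible; hence every copy lies in 𝒮.  Now if u, v ∈ 𝒮 are joined
-- by e, the vertex e⁰ forces ε, after which e⁰ forces y for every edge e = xy with x ∈ 𝒮.  By
-- connectivity 𝒮 is then the whole vertex set, contradicting properness.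

open import Defs
open import Data.Nat using (ℕ; zero; suc; _+_; _*_; _∸_; _≤_; _<_; z≤n; s≤s; z<s; s≤s⁻¹)
open import Data.Nat.Properties
open import Data.Bool using (Bool; true; false; not)
open import Data.Bool.Properties using (not-¬)
open import Data.Fin using (Fin; toℕ; fromℕ; fromℕ<; inject₁) renaming (zero to fzero; suc to fsuc)
open import Data.Fin.Properties using (toℕ-injective; toℕ<n; toℕ-fromℕ; toℕ-fromℕ<; toℕ-inject₁)
open import Data.List using (List; []; _∷_; _++_; map; concatMap; length; filterᵇ; tabulate; allFin)
open import Data.List.Properties using (length-++; length-map; length-tabulate)
open import Data.List.Membership.Propositional using (_∈_)
open import Data.List.Membership.Propositional.Properties using (∈-map⁺; ∈-allFin)
open import Data.List.Relation.Binary.Sublist.Propositional using (_⊆_; from∈)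
open import Data.List.Relation.Binary.Sublist.Propositional.Properties
  using ([]⊆-universal; ++⁺; ++⁺ˡ; ++⁺ʳ; filter⁺; length-mono-≤)
open import Data.List.Relation.Unary.Linked as Linked using (Linked; []; [-]; _∷_)
import Data.List.Relation.Unary.Linked.Properties as Linked
open import Data.Product using (∃; _×_; _,_; proj₁; proj₂)
open import Data.Sum using (_⊎_; inj₁; inj₂; [_,_])
open import Data.Empty using (⊥-elim)
open import Function using (_∘_; id)
open import Relation.Binary.PropositionalEquality
  using (_≡_; refl; sym; trans; cong; cong₂; subst; module ≡-Reasoning)
open import Relation.Nullary using (¬_)
open import Relation.Nullary.Decidable using (T?)

climb : ∀ {P : ℕ → Set} → (∀ k → P k → P (suc k) → P (suc (suc k))) →
        ∀ {a} → P a → P (suc a) → ∀ d → P (d + a)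
climb {P} grow {a} pa pa′ d = proj₁ (pair d)
  where
  pair : ∀ d → P (d + a) × P (suc (d + a))
  pair zero    = pa , pa′
  pair (suc d) = let (p , p′) = pair d in p′ , grow _ p p′

descend : ∀ {P : ℕ → Set} N → (∀ k → k < N → P (suc k) → P (suc (suc k)) → P k) →
          P N → P (suc N) → ∀ k → k ≤ N → P k
descend {P} N shrink pN pN′ k k≤N = proj₁ (pair (N ∸ k) k (m+[n∸m]≡n k≤N))
  where
  pair : ∀ d k → k + d ≡ N → P k × P (suc k)
  pair zero    k eq = subst (λ j → P j × P (suc j)) (sym (trans (sym (+-identityʳ k)) eq)) (pN , pN′)
  pair (suc d) k eq =
    let (p , p′) = pair d (suc k) (trans (sym (+-suc k d)) eq)
    in shrink k (subst (k <_) eq (m<m+n k z<s)) p p′ , p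

2+a≤1+2*[1+c] : ∀ {a c} → a ≤ suc (2 * c) → 2 + a ≤ suc (2 * suc c)
2+a≤1+2*[1+c] {c = c} a≤ rewrite *-suc 2 c = s≤s (s≤s a≤)

length-allFin : ∀ k → length (allFin k) ≡ k
length-allFin k = length-tabulate {n = k} id

module _ {A : Set} where

  Linked-tabulate⁺ : ∀ {R : A → A → Set} {n} (g : Fin (suc n) → A) →
                     (∀ i → R (g (inject₁ i)) (g (fsuc i))) → Linked R (tabulate g)
  Linked-tabulate⁺ {n = zero}  g r = [-]
  Linked-tabulate⁺ {n = suc n} g r = r fzero ∷ Linked-tabulate⁺ (g ∘ fsuc) (r ∘ fsuc)

  map⊆concatMap : ∀ {B : Set} {g : B → A} {h : B → List A} →
                  (∀ x → g x ∈ h x) → ∀ xs → map g xs ⊆ concatMap h xs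
  map⊆concatMap g∈h []       = []⊆-universal _
  map⊆concatMap g∈h (x ∷ xs) = ++⁺ (from∈ (g∈h x)) (map⊆concatMap g∈h xs)

  length-concatMap : ∀ {B : Set} {h : B → List A} {c} →
                     (∀ x → length (h x) ≡ c) → ∀ xs → length (concatMap h xs) ≡ length xs * c
  length-concatMap |h|≡c []       = refl
  length-concatMap {h = h} |h|≡c (x ∷ xs) = begin
    length (h x ++ concatMap h xs)          ≡⟨ length-++ (h x) ⟩
    length (h x) + length (concatMap h xs)  ≡⟨ cong₂ _+_ (|h|≡c x) (length-concatMap |h|≡c xs) ⟩
    _ + length xs * _                       ∎
    where open ≡-Reasoning

  module _ (p : A → Bool) where

    outside : List A → List A
    outside = filterᵇ (not ∘ p)

    length-filterᵇ+length-outside : ∀ xs → length (filterᵇ p xs) + length (outside xs) ≡ length xs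
    length-filterᵇ+length-outside []       = refl
    length-filterᵇ+length-outside (x ∷ xs) with p x
    ... | true  = cong suc (length-filterᵇ+length-outside xs)
    ... | false = trans (+-suc _ _) (cong suc (length-filterᵇ+length-outside xs))

    NotBothIn : A → A → Set
    NotBothIn x y = p x ≡ false ⊎ p y ≡ false

    length≤1+2*|outside| : ∀ {xs} → Linked NotBothIn xs → length xs ≤ suc (2 * length (outside xs))
    length≤1+2*|outside| []              = z≤n
    length≤1+2*|outside| [-]             = s≤s z≤n
    length≤1+2*|outside| {x ∷ ys} (r ∷ l) with p x
    ... | false = ≤-trans (n≤1+n _) (2+a≤1+2*[1+c] {c = length (outside ys)} (length≤1+2*|outside| l))
    ... | true  = second-out r l
      where
      second-out : ∀ {y zs} → true ≡ false ⊎ p y ≡ false → Linked NotBothIn (y ∷ zs) →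
                   suc (length (y ∷ zs)) ≤ suc (2 * length (outside (y ∷ zs)))
      second-out (inj₁ ())
      second-out {y} {zs} (inj₂ py) l rewrite py with l
      ... | [-]    = s≤s (s≤s z≤n)
      ... | _ ∷ l′ = 2+a≤1+2*[1+c] {c = length (outside zs)} (length≤1+2*|outside| l′)

module _ {A : Set} {x y : A} where

  joins-end : ∀ {p : A × A} {z} → p ≡ (x , y) ⊎ p ≡ (y , x) → proj₁ p ≡ z ⊎ proj₂ p ≡ z → z ≡ x ⊎ z ≡ y
  joins-end (inj₁ refl) = [ inj₁ ∘ sym , inj₂ ∘ sym ]
  joins-end (inj₂ refl) = [ inj₂ ∘ sym , inj₁ ∘ sym ]

  joins-second : ∀ {p : A × A} → p ≡ (x , y) ⊎ p ≡ (y , x) → proj₁ p ≡ y ⊎ proj₂ p ≡ y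
  joins-second (inj₁ refl) = inj₂ refl
  joins-second (inj₂ refl) = inj₁ refl

module StalledSet (G : SimpleGraph) (S : Vtx G → Bool) (stalled : Stalled G S) where
  open SimpleGraph G

  In : Vtx G → Set
  In x = S x ≡ true

  stalled-closed : ∀ {x y} → In x → Adj G x y → (∀ z → Adj G x z → z ≡ y ⊎ In z) → In y
  stalled-closed {x} {y} x∈ xy others with S y in y∉
  ... | true  = refl
  ... | false = ⊥-elim (stalled y (not-¬ y∉ , x , x∈ , xy , only-y))
    where
    only-y : ∀ z → Adj G x z → ¬ In z → z ≡ y
    only-y z xz z∉ = [ id , ⊥-elim ∘ z∉ ] (others z xz)

  -- The copy of f at height c lies in S; vacuously true for c > 2n.
  CopiesIn : Fin m → ℕ → Set
  CopiesIn f c = ∀ i → toℕ i ≡ c → In (edg i f)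

  In⇒CopiesIn : ∀ {f i} → In (edg i f) → CopiesIn f (toℕ i)
  In⇒CopiesIn {f} e∈ j j≡i = subst (λ k → In (edg k f)) (sym (toℕ-injective j≡i)) e∈

  interior-neighbours : ∀ {f j c w} → toℕ j ≡ suc c → Adj G (edg j f) w →
                        ∃ λ l → w ≡ edg l f × (toℕ l ≡ c ⊎ toℕ l ≡ suc (suc c))
  interior-neighbours j≡ (inj₁ (edg-edg _ l _ l≡)) = l , refl , inj₂ (trans l≡ (cong suc j≡))
  interior-neighbours j≡ (inj₂ (edg-edg l _ _ j≡′)) = l , refl , inj₁ (suc-injective (trans (sym j≡′) j≡))
  interior-neighbours () (inj₂ (vert-edg _ _ _))
  interior-neighbours () (inj₂ (eps-edg _))

  copies-up : ∀ {f} c → CopiesIn f c → CopiesIn f (suc c) → CopiesIn f (suc (suc c))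
  copies-up {f} c below at (fsuc i) i≡ =
    stalled-closed (at (inject₁ i) j≡) (inj₁ (edg-edg _ _ _ (cong suc (sym (toℕ-inject₁ i))))) others
    where
    j≡ : toℕ (inject₁ i) ≡ suc c
    j≡ = trans (toℕ-inject₁ i) (suc-injective i≡)
    others : ∀ z → Adj G (edg (inject₁ i) f) z → z ≡ edg (fsuc i) f ⊎ In z
    others z a with interior-neighbours j≡ a
    ... | l , refl , inj₁ l≡ = inj₂ (below l l≡)
    ... | l , refl , inj₂ l≡ = inj₁ (cong (λ k → edg k f) (toℕ-injective (trans l≡ (sym i≡))))

  copies-down : ∀ {f} c → c < 2 * n → CopiesIn f (suc c) → CopiesIn f (suc (suc c)) → CopiesIn f c
  copies-down {f} c c<2n at above i i≡ =
    stalled-closed (at j j≡) (inj₂ (edg-edg _ _ _ (trans j≡ (cong suc (sym i≡))))) others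
    where
    j : Fin (suc (2 * n))
    j = fromℕ< (s≤s c<2n)
    j≡ : toℕ j ≡ suc c
    j≡ = toℕ-fromℕ< (s≤s c<2n)
    others : ∀ z → Adj G (edg j f) z → z ≡ edg i f ⊎ In z
    others z a with interior-neighbours j≡ a
    ... | l , refl , inj₁ l≡ = inj₁ (cong (λ k → edg k f) (toℕ-injective (trans l≡ (sym i≡))))
    ... | l , refl , inj₂ l≡ = inj₂ (above l l≡)

  bottom-neighbours : ∀ {e x y w} → ends e ≡ (x , y) ⊎ ends e ≡ (y , x) → Adj G (edg fzero e) w →
                      (∃ λ k → w ≡ edg k e) ⊎ w ≡ eps ⊎ w ≡ vert x ⊎ w ≡ vert y
  bottom-neighbours _     (inj₁ (edg-edg _ k _ _)) = inj₁ (k , refl)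
  bottom-neighbours _     (inj₂ (edg-edg _ _ _ ()))
  bottom-neighbours joins (inj₂ (vert-edg _ _ end)) =
    inj₂ (inj₂ ([ inj₁ ∘ cong vert , inj₂ ∘ cong vert ] (joins-end joins end)))
  bottom-neighbours _     (inj₂ (eps-edg _)) = inj₂ (inj₁ refl)

  module _ (copies∈ : ∀ e k → In (edg k e)) where

    eps-forced : ∀ {x y} → AdjG G x y → In (vert x) → In (vert y) → In eps
    eps-forced (e , joins) x∈ y∈ = stalled-closed (copies∈ e fzero) (inj₂ (eps-edg e)) others
      where
      others : ∀ z → Adj G (edg fzero e) z → z ≡ eps ⊎ In z
      others z a with bottom-neighbours joins a
      ... | inj₁ (k , refl)         = inj₂ (copies∈ e k)
      ... | inj₂ (inj₁ refl)        = inj₁ refl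
      ... | inj₂ (inj₂ (inj₁ refl)) = inj₂ x∈
      ... | inj₂ (inj₂ (inj₂ refl)) = inj₂ y∈

    vert-forced : In eps → ∀ {x y} → AdjG G x y → In (vert x) → In (vert y)
    vert-forced ε∈ {y = y} (e , joins) x∈ =
      stalled-closed (copies∈ e fzero) (inj₂ (vert-edg y e (joins-second joins))) others
      where
      others : ∀ z → Adj G (edg fzero e) z → z ≡ vert y ⊎ In z
      others z a with bottom-neighbours joins a
      ... | inj₁ (k , refl)         = inj₂ (copies∈ e k)
      ... | inj₂ (inj₁ refl)        = inj₂ ε∈
      ... | inj₂ (inj₂ (inj₁ refl)) = inj₂ x∈
      ... | inj₂ (inj₂ (inj₂ refl)) = inj₁ refl

    walk-closed : In eps → ∀ {x y} → Reach G x y → In (vert x) → In (vert y)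
    walk-closed ε∈ here         = id
    walk-closed ε∈ (step xy r) = walk-closed ε∈ r ∘ vert-forced ε∈ xy

  copy : Fin m → Fin (suc (2 * n)) → Vtx G
  copy f i = edg i f

  copies : Fin m → List (Vtx G)
  copies f = map (copy f) (allFin (suc (2 * n)))

  length-copies : ∀ f → length (copies f) ≡ suc (2 * n)
  length-copies f = trans (length-map (copy f) (allFin (suc (2 * n)))) (length-allFin (suc (2 * n)))

  copies⊆allVtx : ∀ f → copies f ⊆ allVtx G
  copies⊆allVtx f = ++⁺ˡ (map vert (allFin n)) (++⁺ʳ (eps ∷ [])
    (map⊆concatMap (λ i → ∈-map⁺ (edg i) (∈-allFin f)) (allFin (suc (2 * n)))))

  length-allVtx : length (allVtx G) ≡ n + (suc (2 * n) * m + 1)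
  length-allVtx = begin
    length (vertices ++ (edge-copies ++ eps ∷ []))          ≡⟨ length-++ vertices ⟩
    length vertices + length (edge-copies ++ eps ∷ [])      ≡⟨ cong (length vertices +_) (length-++ edge-copies) ⟩
    length vertices + (length edge-copies + 1)              ≡⟨ cong₂ (λ a b → a + (b + 1)) |vertices| |edge-copies| ⟩
    n + (suc (2 * n) * m + 1)                               ∎
    where
    open ≡-Reasoning
    vertices edge-copies : List (Vtx G)
    vertices = map vert (allFin n)
    edge-copies = concatMap (λ i → map (edg i) (allFin m)) (allFin (suc (2 * n)))
    |vertices| : length vertices ≡ n
    |vertices| = trans (length-map vert (allFin n)) (length-allFin n)
    |edge-copies| : length edge-copies ≡ suc (2 * n) * m
    |edge-copies| = trans (length-concatMap {h = λ i → map (edg i) (allFin m)}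
                                            (λ i → trans (length-map (edg i) (allFin m)) (length-allFin m))
                                            (allFin (suc (2 * n))))
                          (cong (_* m) (length-allFin (suc (2 * n))))

  outside-copies≤ : ∀ f → length (outside S (copies f)) ≤ length (outside S (allVtx G))
  outside-copies≤ f = length-mono-≤ (filter⁺ (T? ∘ not ∘ S) (T? ∘ not ∘ S) (λ { refl → id }) (copies⊆allVtx f))

  top : Fin (suc (2 * n))
  top = fromℕ (2 * n)

  top-out⇒linked : ∀ {f} → ¬ In (edg top f) → Linked (NotBothIn S) (copies f)
  top-out⇒linked {f} top∉ = Linked.map⁺ (Linked-tabulate⁺ id not-both)
    where
    reaches-top : ∀ {c} → c ≤ 2 * n → CopiesIn f c → CopiesIn f (suc c) → In (edg top f)
    reaches-top {c} c≤2n at-c at-c+1 =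
      subst (CopiesIn f) (m∸n+n≡m c≤2n) (climb copies-up at-c at-c+1 (2 * n ∸ c)) top (toℕ-fromℕ (2 * n))

    not-both : ∀ i → S (copy f (inject₁ i)) ≡ false ⊎ S (copy f (fsuc i)) ≡ false
    not-both i with S (copy f (inject₁ i)) in i∈ | S (copy f (fsuc i)) in i∈′
    ... | false | _     = inj₁ refl
    ... | true  | false = inj₂ refl
    ... | true  | true  = ⊥-elim (top∉ (reaches-top (<⇒≤ (toℕ<n i))
                            (subst (CopiesIn f) (toℕ-inject₁ i) (In⇒CopiesIn i∈)) (In⇒CopiesIn i∈′)))

  module _ (large : suc (2 * n) * m + 2 ≤ card G S) where

    few-outside : length (outside S (allVtx G)) < n
    few-outside = +-cancelˡ-≤ (K + 1) _ _ (begin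
      K + 1 + suc o       ≡⟨ trans (+-assoc K 1 (suc o)) (sym (+-assoc K 2 o)) ⟩
      K + 2 + o           ≤⟨ +-monoˡ-≤ o large ⟩
      card G S + o        ≡⟨ length-filterᵇ+length-outside S (allVtx G) ⟩
      length (allVtx G)   ≡⟨ length-allVtx ⟩
      n + (K + 1)         ≡⟨ +-comm n (K + 1) ⟩
      K + 1 + n           ∎)
      where
      open ≤-Reasoning
      K o : ℕ
      K = suc (2 * n) * m
      o = length (outside S (allVtx G))

    top-in : ∀ f → CopiesIn f (2 * n)
    top-in f with S (edg top f) in S-top
    ... | true  = subst (CopiesIn f) (toℕ-fromℕ (2 * n)) (In⇒CopiesIn S-top)
    ... | false = ⊥-elim (<⇒≱ few-outside (≤-trans n≤outside (outside-copies≤ f)))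
      where
      open ≤-Reasoning
      n≤outside : n ≤ length (outside S (copies f))
      n≤outside = *-cancelˡ-≤ 2 (s≤s⁻¹ (begin
        suc (2 * n)                                ≡⟨ sym (length-copies f) ⟩
        length (copies f)                          ≤⟨ length≤1+2*|outside| S (top-out⇒linked (not-¬ S-top)) ⟩
        suc (2 * length (outside S (copies f)))    ∎))

    all-copies-in : ∀ e i → In (edg i e)
    all-copies-in e i =
      descend {P = CopiesIn e} (2 * n) copies-down (top-in e) nothing-above (toℕ i) (s≤s⁻¹ (toℕ<n i)) i refl
      where
      nothing-above : CopiesIn e (suc (2 * n))
      nothing-above j j≡ = ⊥-elim (<-irrefl j≡ (toℕ<n j))

mainTheorem8 : (G : SimpleGraph) → Connected G → (S : Vtx G → Bool) →
    Proper G S → Stalled G S →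
    (suc (2 * SimpleGraph.n G)) * SimpleGraph.m G + 2 ≤ card G S →
    IndependentG G (λ u → S (vert u) ≡ true)
mainTheorem8 G connected S proper stalled large u v uv (u∈ , v∈) = proper everything
  where
  open StalledSet G S stalled
  copies∈ : ∀ e i → In (edg i e)
  copies∈ = all-copies-in large
  ε∈ : In eps
  ε∈ = eps-forced copies∈ uv u∈ v∈
  everything : ∀ w → In w
  everything (vert w)  = walk-closed copies∈ ε∈ (connected u w) u∈
  everything (edg i e) = copies∈ e i
  everything eps       = ε∈
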